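{- Fix any $\alpha \in \mathbb{R} \setminus \mathbb{Q}$ and $N \in \mathbb{N}$, and let $W$ be the word generated by the corresponding gaps on the circle. Then for any $c$ in $W$, the $k^{\text{th}}$ letter to the right of it is always the same as the $k^{\text{th}}$ letter to the left of it, so long as the index $k$ is smaller than the index of the first $c$ occurrence on either side. More precisely, if $W_{J} = c$, then $W_{J - k} = W_{J + k}$ for $k = 0, \dots, \ell$ where $\ell + 1$ is the smallest index such that $W_{J - (\ell + 1)} = c \text{ or } W_{J + (\ell + 1)} = c$.
   Context: For $\alpha \in \mathbb{R}\setminus\mathbb{Q}$ and $N \in \mathbb{N}$, order the fractional parts $\{m\alpha\}$, $0 \le m < N$, as $0 = y_0(N) < y_1(N) < \dots < y_{N-1}(N) < 1$. The gaps are $\delta_j(N) = y_{j+1}(N) - y_j(N)$ for $j = 0,\dots,N-2$ and $\delta_{N-1}(N) = 1 - y_{N-1}(N)$. By the Three Gap Theorem the gaps take at most three distinct values. The word $W = W(N)$ in the letters $a, b, c$ has $j^{\text{th}}$ letter $W_j$ equal to $a$, $b$, or $c$ according as $\delta_j(N)$ is the smallest, medium-sized, or largest gap length; the word is interpreted cyclically, $W_j = W_{j \bmod N}$. -}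

module Defs where

open import Data.Bool using (Bool; true; false; if_then_else_)
open import Data.Nat as ℕ using (ℕ; NonZero)
open import Data.Integer as ℤ using (ℤ; +_; +[1+_]; -[1+_]; 0ℤ; 1ℤ; _-_; -_; _+_)
open import Data.Integer.DivMod using (_%ℕ_; n%ℕd<d)
open import Data.Rational as ℚ using (ℚ; _/_)
open import Data.Fin as Fin using (Fin; toℕ; fromℕ<)
open import Data.Fin.Properties using (all?)
open import Data.Product using (_×_; _,_; ∃; proj₁; proj₂)
open import Data.Sum using (_⊎_)
open import Relation.Binary.PropositionalEquality using (_≡_; refl)
open import Relation.Nullary using (Dec; yes; no; does; _×-dec_; _⊎-dec_; map′)
open import Data.Bool.Properties using () renaming (_≟_ to _≟ᵇ_)

-- An irrational real number α, given as a (decidable) Dedekind cut on ℚ: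
-- lt q = true  ⇔  q < α.  The lower set is inhabited, the upper set is
-- inhabited, the lower set is downward closed and has no maximum, and the
-- upper set has no minimum (i.e. α is not rational).
record IrrationalReal : Set where
  field
    lt         : ℚ → Bool
    inhabited  : ∃ λ q → lt q ≡ true
    bounded    : ∃ λ q → lt q ≡ false
    downClosed : ∀ p q → p ℚ.≤ q → lt q ≡ true → lt p ≡ true
    noMax      : ∀ q → lt q ≡ true → ∃ λ r → q ℚ.< r × lt r ≡ true
    noMin      : ∀ q → lt q ≡ false → ∃ λ r → r ℚ.< q × lt r ≡ false
open IrrationalReal public

-- Numbers of the form  a·α + b  with a b ∈ ℤ, represented by the pair (a , b).
Lin : Set
Lin = ℤ × ℤ

_⊕_ : Lin → Lin → Lin
(a , b) ⊕ (a' , b') = (a + a' , b + b')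

_⊖_ : Lin → Lin → Lin
(a , b) ⊖ (a' , b') = (a - a' , b - b')

-- Positivity of a·α + b.
Pos : IrrationalReal → ℤ → ℤ → Set
Pos α (+ 0)      b = 0ℤ ℤ.< b
Pos α +[1+ n ]   b = lt α ((- b) / ℕ.suc n) ≡ true
Pos α -[1+ n ]   b = lt α (b / ℕ.suc n) ≡ false

pos? : (α : IrrationalReal) → (a b : ℤ) → Dec (Pos α a b)
pos? α (+ 0)    b = 0ℤ ℤ.<? b
pos? α +[1+ n ] b = lt α ((- b) / ℕ.suc n) ≟ᵇ true
pos? α -[1+ n ] b = lt α (b / ℕ.suc n) ≟ᵇ false

_<[_]_ : Lin → IrrationalReal → Lin → Set
x <[ α ] y = Pos α (proj₁ (y ⊖ x)) (proj₂ (y ⊖ x))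

_≤[_]_ : Lin → IrrationalReal → Lin → Set
x ≤[ α ] y = x <[ α ] y ⊎ x ≡ y

_≟L_ : (x y : Lin) → Dec (x ≡ y)
(a , b) ≟L (a' , b') = map′ (λ { (refl , refl) → refl }) (λ { refl → (refl , refl) })
                            ((a ℤ.≟ a') ×-dec (b ℤ.≟ b'))

≤? : (α : IrrationalReal) → (x y : Lin) → Dec (x ≤[ α ] y)
≤? α x y = pos? α _ _ ⊎-dec (x ≟L y)

-- fl is the floor function m ↦ ⌊mα⌋ (characterised by its specification
-- below), so the fractional part {mα} is the number (m , -fl m).
-- σ lists the indices m < N in increasing order of {mα}, so that
-- y_j(N) = {σ(j) α}.

IsFloor : IrrationalReal → (ℕ → ℤ) → Set
IsFloor α fl = ∀ (m : ℕ) → ((+ 0 , + 0) ≤[ α ] (+ m , - fl m))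
                         × ((+ m , - fl m) <[ α ] (+ 0 , + 1))

frac : (ℕ → ℤ) → ℕ → Lin
frac fl m = (+ m , - fl m)

IsSorting : IrrationalReal → (ℕ → ℤ) → (N : ℕ) → (Fin N → Fin N) → Set
IsSorting α fl N σ = ∀ (i j : Fin N) → toℕ i ℕ.< toℕ j →
                     frac fl (toℕ (σ i)) <[ α ] frac fl (toℕ (σ j))

-- y_j for j ≤ N, with y_N := 1.
yAt : (fl : ℕ → ℤ) (N : ℕ) → (Fin N → Fin N) → ℕ → Lin
yAt fl N σ j with j ℕ.<? N
... | yes p = frac fl (toℕ (σ (fromℕ< p)))
... | no _  = (+ 0 , + 1)

gap : (fl : ℕ → ℤ) (N : ℕ) → (Fin N → Fin N) → Fin N → Lin
gap fl N σ j = yAt fl N σ (ℕ.suc (toℕ j)) ⊖ yAt fl N σ (toℕ j)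

data Letter : Set where
  a b c : Letter

letter : IrrationalReal → (fl : ℕ → ℤ) (N : ℕ) → (Fin N → Fin N) → Fin N → Letter
letter α fl N σ j =
  if does (all? (λ i → ≤? α (gap fl N σ i) (gap fl N σ j))) then c
  else if does (all? (λ i → ≤? α (gap fl N σ j) (gap fl N σ i))) then a
  else b

-- The word read cyclically, indexed by ℤ:  W_J = W_{J mod N}.
W : IrrationalReal → (fl : ℕ → ℤ) (N : ℕ) → .{{NonZero N}} → (Fin N → Fin N) → ℤ → Letter
W α fl N σ J = letter α fl N σ (fromℕ< (n%ℕd<d J N))

-- Let {uα} and {vα} be the smallest and the largest of the points {dα},
-- 0 < d < N. Going up on the circle from {mα}, the next point is {(m+u)α}
-- if m + u < N, else {(m-v)α} if m ≥ v, else {(m+u-v)α}, and the gap is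
-- {uα}, 1 - {vα} or their sum: this is the three gap theorem. Let the gap
-- from {pα} to {qα} carry the letter c and walk outwards on both sides. While
-- no further c is met, both new gaps are strictly shorter than the c-gap, which
-- rules out its own kind and, unless it is the wide one, the wide kind too;
-- meanwhile the indices L on the left and R on the right keep L + R = p + q.
-- That sum also rules out one new gap of kind +u next to one of kind -v, so the
-- two new gaps are of the same kind, hence of the same length.
--
-- A number aα + b is handled as the pair (a , b); positivity is decided by the
-- Dedekind cut of α, and positive numbers add up by the mediant inequality.

module Submission where

open import Defs
open import Data.Bool using (true; false; if_then_else_)
open import Data.Empty using (⊥; ⊥-elim)
open import Data.Fin as Fin using (Fin; toℕ; fromℕ<)
import Data.Fin.Properties as Fin
open import Data.Integer as ℤ using (ℤ; +_; +[1+_]; -[1+_]; 0ℤ; _+_; _-_; _*_; -_)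
open import Data.Integer.DivMod using (_%ℕ_; _/ℕ_; n%ℕd<d; a≡a%ℕn+[a/ℕn]*n)
import Data.Integer.Properties as ℤ
open import Data.Integer.Tactic.RingSolver using (solve-∀)
open import Data.Nat as ℕ using (ℕ; zero; suc; _<_; _≤_; NonZero)
import Data.Nat.Properties as ℕ
import Data.Nat.Tactic.RingSolver as ℕ-Solver
open import Data.Product using (_×_; _,_; proj₁; proj₂; ∃; uncurry)
open import Data.Rational as ℚ using (_/_)
import Data.Rational.Properties as ℚ
import Data.Rational.Unnormalised as ℚᵘ
import Data.Rational.Unnormalised.Properties as ℚᵘ
open import Data.Sum using (_⊎_; inj₁; inj₂; map₁)
open import Function.Base using (_∘_)
open import Function.Definitions using (Injective)
open import Relation.Binary.Definitions
  using (Irreflexive; Transitive; Asymmetric; Antisymmetric; Trans; Trichotomous; tri<; tri≈; tri>)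
import Relation.Binary.Construct.StrictToNonStrict as ToNonStrict
import Relation.Binary.PropositionalEquality as ≡
open import Relation.Binary.PropositionalEquality
  using (_≡_; _≢_; refl; sym; trans; cong; cong₂; subst; subst₂)
open import Relation.Nullary using (¬_; Dec; yes; no; does)

≤-from-≡-diff : ∀ {i j} k l → i ℤ.≤ j → l - k ≡ j - i → k ℤ.≤ l
≤-from-≡-diff _ _ i≤j eq = ℤ.0≤i-j⇒j≤i (subst (0ℤ ℤ.≤_) (sym eq) (ℤ.i≤j⇒0≤j-i i≤j))

*≤*⇒/≤/ : ∀ p q m n → p * + suc n ℤ.≤ q * + suc m → p / suc m ℚ.≤ q / suc n
*≤*⇒/≤/ p q m n le = ℚ.toℚᵘ-cancel-≤
  (ℚᵘ.≤-respˡ-≃ (ℚᵘ.≃-sym (ℚ.toℚᵘ-fromℚᵘ (ℚᵘ.mkℚᵘ p m)))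
    (ℚᵘ.≤-respʳ-≃ (ℚᵘ.≃-sym (ℚ.toℚᵘ-fromℚᵘ (ℚᵘ.mkℚᵘ q n))) (ℚᵘ.*≤* le)))

-- For q, s > 0 the mediant (p + r)/(q + s) lies between p/q and r/s. All four
-- statements are cross-multiplied, and each is equivalent to p s ≤ r q.
module _ (p q r s : ℤ) where

  mediant-≥ˡ : p * s ℤ.≤ r * q → p * (q + s) ℤ.≤ (p + r) * q
  mediant-≥ˡ le = ≤-from-≡-diff _ _ le (identity p q r s)
    where identity : ∀ p q r s → (p + r) * q - p * (q + s) ≡ r * q - p * s
          identity = solve-∀

  mediant-≥ˡ⁻¹ : p * (q + s) ℤ.≤ (p + r) * q → p * s ℤ.≤ r * q
  mediant-≥ˡ⁻¹ le = ≤-from-≡-diff _ _ le (identity p q r s)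
    where identity : ∀ p q r s → r * q - p * s ≡ (p + r) * q - p * (q + s)
          identity = solve-∀

  mediant-≤ʳ : p * s ℤ.≤ r * q → (p + r) * s ℤ.≤ r * (q + s)
  mediant-≤ʳ le = ≤-from-≡-diff _ _ le (identity p q r s)
    where identity : ∀ p q r s → r * (q + s) - (p + r) * s ≡ r * q - p * s
          identity = solve-∀

  mediant-≤ʳ⁻¹ : (p + r) * s ℤ.≤ r * (q + s) → p * s ℤ.≤ r * q
  mediant-≤ʳ⁻¹ le = ≤-from-≡-diff _ _ le (identity p q r s)
    where identity : ∀ p q r s → r * q - p * s ≡ r * (q + s) - (p + r) * s
          identity = solve-∀

sub-add : ∀ x y → x ≡ (x - y) + y
sub-add = solve-∀

sub-sub : ∀ x y → y ≡ x - (x - y)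
sub-sub = solve-∀

positive-sum≢1 : ∀ {i j} → 0ℤ ℤ.< i → 0ℤ ℤ.< j → i + j ≢ + 1
positive-sum≢1 {+[1+ m ]} {+[1+ n ]} _ _ eq
  with () ← trans (sym (ℕ.+-suc m n)) (ℕ.suc-injective (ℤ.+-injective eq))
positive-sum≢1 {+ 0} (ℤ.+<+ ())
positive-sum≢1 {+[1+ _ ]} {+ 0} _ (ℤ.+<+ ())

+[d+m]-+m : ∀ d m → + (d ℕ.+ m) - + m ≡ + d
+[d+m]-+m d m = trans (cong (_- + m) (ℤ.pos-+ d m)) (identity (+ d) (+ m))
  where identity : ∀ x y → (x + y) - y ≡ x
        identity = solve-∀

+m-+[d+m] : ∀ d m → + m - + (d ℕ.+ m) ≡ - + d
+m-+[d+m] d m = trans (cong (λ x → + m - x) (ℤ.pos-+ d m)) (identity (+ d) (+ m))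
  where identity : ∀ x y → y - (x + y) ≡ - x
        identity = solve-∀

i+l≡k+j⇒i-j≡k-l : ∀ i j k l → i + l ≡ k + j → i - j ≡ k - l
i+l≡k+j⇒i-j≡k-l i j k l eq = trans (identity₁ i j l) (trans (cong (_- (j + l)) eq) (identity₂ k j l))
  where identity₁ : ∀ i j l → i - j ≡ (i + l) - (j + l)
        identity₁ = solve-∀
        identity₂ : ∀ k j l → (k + j) - (j + l) ≡ k - l
        identity₂ = solve-∀

i-j≡k-l⇒i+l≡k+j : ∀ i j k l → i - j ≡ k - l → i + l ≡ k + j
i-j≡k-l⇒i+l≡k+j i j k l eq = trans (identity₁ i j l) (trans (cong (λ x → (x + l) + j) eq) (identity₂ k j l))
  where identity₁ : ∀ i j l → i + l ≡ ((i - j) + l) + j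
        identity₁ = solve-∀
        identity₂ : ∀ k j l → ((k - l) + l) + j ≡ k + j
        identity₂ = solve-∀

injective⇒surjective : ∀ {n} (f : Fin n → Fin n) → Injective _≡_ _≡_ f → ∀ t → ∃ λ i → f i ≡ t
injective⇒surjective {suc n} f f-inj t with Fin.any? (λ i → f i Fin.≟ t)
... | yes hit = hit
... | no miss = ⊥-elim (Fin.<⇒notInjective (ℕ.n<1+n n) f′-inj)
  where
  f′ : Fin (suc n) → Fin n
  f′ i = Fin.punchOut {i = t} {j = f i} (λ t≡fi → miss (i , sym t≡fi))
  f′-inj : Injective _≡_ _≡_ f′
  f′-inj {i} {j} eq =
    f-inj (Fin.punchOut-injective (λ t≡fi → miss (i , sym t≡fi)) (λ t≡fj → miss (j , sym t≡fj)) eq)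

overshoot : ∀ {N r r′ q q′} → q ℤ.< q′ → + r + q * + N ≡ + r′ + q′ * + N → N ≤ r
overshoot {N} {r} {r′} {q} {q′} q<q′ eq = ℤ.drop‿+≤+ (begin
  + N                   ≡⟨ ℤ.*-identityˡ (+ N) ⟨
  + 1 * + N             ≤⟨ ℤ.*-monoʳ-≤-nonNeg (+ N) 1≤q′-q ⟩
  (q′ - q) * + N        ≤⟨ ℤ.i≤j+i _ (+ r′) ⟩
  + r′ + (q′ - q) * + N ≡⟨ shifted ⟨
  + r                   ∎)
  where
  open ℤ.≤-Reasoning
  1≤q′-q : + 1 ℤ.≤ q′ - q
  1≤q′-q = ≤-from-≡-diff (+ 1) (q′ - q) (ℤ.i<j⇒suc[i]≤j q<q′) (identity q q′)
    where identity : ∀ q q′ → (q′ - q) - + 1 ≡ q′ - (+ 1 + q)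
          identity = solve-∀
  shifted : + r ≡ + r′ + (q′ - q) * + N
  shifted = trans (identity₁ (+ r) q (+ N)) (trans (cong (_- q * + N) eq) (identity₂ (+ r′) q q′ (+ N)))
    where identity₁ : ∀ r q n → r ≡ (r + q * n) - q * n
          identity₁ = solve-∀
          identity₂ : ∀ r′ q q′ n → (r′ + q′ * n) - q * n ≡ r′ + (q′ - q) * n
          identity₂ = solve-∀

remainder-unique : ∀ {N r r′} q q′ → r < N → r′ < N → + r + q * + N ≡ + r′ + q′ * + N → r ≡ r′
remainder-unique {N} {r} {r′} q q′ r<N r′<N eq with ℤ.<-cmp q q′
... | tri< q<q′ _ _ = ⊥-elim (ℕ.<⇒≱ r<N (overshoot q<q′ eq))
... | tri> _ _ q′<q = ⊥-elim (ℕ.<⇒≱ r′<N (overshoot q′<q (sym eq)))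
... | tri≈ _ refl _ = ℤ.+-injective (trans (identity (+ r) (q * + N))
                        (trans (cong (_- q * + N) eq) (sym (identity (+ r′) (q * + N)))))
  where identity : ∀ x y → x ≡ (x + y) - y
        identity = solve-∀

+1-decomposition : ∀ {N} .{{_ : NonZero N}} J → J + + 1 ≡ + suc (J %ℕ N) + (J /ℕ N) * + N
+1-decomposition {N} J = trans (cong (_+ + 1) (a≡a%ℕn+[a/ℕn]*n J N)) (identity (+ (J %ℕ N)) (J /ℕ N) (+ N))
  where identity : ∀ r q n → (r + q * n) + + 1 ≡ (+ 1 + r) + q * n
        identity = solve-∀

%ℕ-unique : ∀ {N} .{{_ : NonZero N}} J r q → r < N → J ≡ + r + q * + N → J %ℕ N ≡ r
%ℕ-unique {N} J r q r<N eq =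
  remainder-unique (J /ℕ N) q (n%ℕd<d J N) r<N (trans (sym (a≡a%ℕn+[a/ℕn]*n J N)) eq)

%ℕ-suc : ∀ {N} .{{_ : NonZero N}} J →
         (J + + 1) %ℕ N ≡ suc (J %ℕ N) ⊎ (suc (J %ℕ N) ≡ N × (J + + 1) %ℕ N ≡ 0)
%ℕ-suc {N} J with suc (J %ℕ N) ℕ.<? N
... | yes 1+r<N = inj₁ (%ℕ-unique (J + + 1) (suc (J %ℕ N)) (J /ℕ N) 1+r<N (+1-decomposition J))
... | no 1+r≮N = inj₂ (1+r≡N , %ℕ-unique (J + + 1) 0 (J /ℕ N + + 1) (ℕ.m<n⇒0<n (n%ℕd<d J N))
                   (trans (+1-decomposition J) (trans (cong (λ x → + x + J /ℕ N * + N) 1+r≡N)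
                                                      (identity (J /ℕ N) (+ N)))))
  where
  1+r≡N : suc (J %ℕ N) ≡ N
  1+r≡N = ℕ.≤-antisym (n%ℕd<d J N) (ℕ.≮⇒≥ 1+r≮N)
  identity : ∀ q n → n + q * n ≡ + 0 + (q + + 1) * n
  identity = solve-∀

position : ∀ {N} .{{_ : NonZero N}} → ℤ → Fin N
position {N} J = fromℕ< (n%ℕd<d J N)

0ᴸ 1ᴸ : Lin
0ᴸ = (0ℤ , 0ℤ)
1ᴸ = (0ℤ , + 1)

⊕-identityʳ : ∀ X → X ⊕ 0ᴸ ≡ X
⊕-identityʳ (x , x′) = cong₂ _,_ (ℤ.+-identityʳ x) (ℤ.+-identityʳ x′)

⊕-identityˡ : ∀ X → 0ᴸ ⊕ X ≡ X
⊕-identityˡ (x , x′) = cong₂ _,_ (ℤ.+-identityˡ x) (ℤ.+-identityˡ x′)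

⊖-identityʳ : ∀ X → X ⊖ 0ᴸ ≡ X
⊖-identityʳ (x , x′) = cong₂ _,_ (ℤ.+-identityʳ x) (ℤ.+-identityʳ x′)

⊖-self : ∀ X → X ⊖ X ≡ 0ᴸ
⊖-self (x , x′) = cong₂ _,_ (ℤ.+-inverseʳ x) (ℤ.+-inverseʳ x′)

⊖-telescope : ∀ X Y Z → (Y ⊖ X) ⊕ (Z ⊖ Y) ≡ Z ⊖ X
⊖-telescope (x , x′) (y , y′) (z , z′) = cong₂ _,_ (identity x y z) (identity x′ y′ z′)
  where identity : ∀ x y z → (y - x) + (z - y) ≡ z - x
        identity = solve-∀

⊖-⊖-cancel : ∀ X Y → X ⊖ (X ⊖ Y) ≡ Y
⊖-⊖-cancel (x , x′) (y , y′) = cong₂ _,_ (identity x y) (identity x′ y′)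
  where identity : ∀ x y → x - (x - y) ≡ y
        identity = solve-∀

⊕-⊖-cancelʳ : ∀ X Y → (X ⊕ Y) ⊖ Y ≡ X
⊕-⊖-cancelʳ (x , x′) (y , y′) = cong₂ _,_ (identity x y) (identity x′ y′)
  where identity : ∀ x y → (x + y) - y ≡ x
        identity = solve-∀

⊕-⊖-cancelˡ : ∀ X Y → (X ⊕ Y) ⊖ X ≡ Y
⊕-⊖-cancelˡ (x , x′) (y , y′) = cong₂ _,_ (identity x y) (identity x′ y′)
  where identity : ∀ x y → (x + y) - x ≡ y
        identity = solve-∀

⊖-⊕ : ∀ X Y Z → (X ⊖ Y) ⊖ Z ≡ X ⊖ (Y ⊕ Z)
⊖-⊕ (x , x′) (y , y′) (z , z′) = cong₂ _,_ (identity x y z) (identity x′ y′ z′)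
  where identity : ∀ x y z → (x - y) - z ≡ x - (y + z)
        identity = solve-∀

⊖-⊖ : ∀ X Y Z → X ⊖ (Y ⊖ Z) ≡ (X ⊖ Y) ⊕ Z
⊖-⊖ (x , x′) (y , y′) (z , z′) = cong₂ _,_ (identity x y z) (identity x′ y′ z′)
  where identity : ∀ x y z → x - (y - z) ≡ (x - y) + z
        identity = solve-∀

⊖-⊖-cancelˡ : ∀ X Y Z → (X ⊖ Y) ⊖ (X ⊖ Z) ≡ Z ⊖ Y
⊖-⊖-cancelˡ (x , x′) (y , y′) (z , z′) = cong₂ _,_ (identity x y z) (identity x′ y′ z′)
  where identity : ∀ x y z → (x - y) - (x - z) ≡ z - y
        identity = solve-∀

⊖-⊕-⊖ʳ : ∀ X Y Z → X ⊖ (Y ⊕ (X ⊖ Z)) ≡ Z ⊖ Y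
⊖-⊕-⊖ʳ (x , x′) (y , y′) (z , z′) = cong₂ _,_ (identity x y z) (identity x′ y′ z′)
  where identity : ∀ x y z → x - (y + (x - z)) ≡ z - y
        identity = solve-∀

⊖-⊖-⊕-⊖ : ∀ X Y U Z → (X ⊖ Y) ⊖ (U ⊕ (X ⊖ Z)) ≡ (Z ⊖ Y) ⊖ U
⊖-⊖-⊕-⊖ (x , x′) (y , y′) (u , u′) (z , z′) = cong₂ _,_ (identity x y u z) (identity x′ y′ u′ z′)
  where identity : ∀ x y u z → (x - y) - (u + (x - z)) ≡ (z - y) - u
        identity = solve-∀

⊖-⊖-cancelʳ : ∀ X Y Z → (Y ⊖ Z) ⊖ (X ⊖ Z) ≡ Y ⊖ X
⊖-⊖-cancelʳ (x , x′) (y , y′) (z , z′) = cong₂ _,_ (identity x y z) (identity x′ y′ z′)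
  where identity : ∀ x y z → (y - z) - (x - z) ≡ y - x
        identity = solve-∀

⊖-⊕-⊖ˡ : ∀ X Y Z → X ⊖ ((X ⊖ Y) ⊕ Z) ≡ Y ⊖ Z
⊖-⊕-⊖ˡ (x , x′) (y , y′) (z , z′) = cong₂ _,_ (identity x y z) (identity x′ y′ z′)
  where identity : ∀ x y z → x - ((x - y) + z) ≡ y - z
        identity = solve-∀

neg-⊖ : ∀ X Y → (- proj₁ (X ⊖ Y) , - proj₂ (X ⊖ Y)) ≡ Y ⊖ X
neg-⊖ (x , x′) (y , y′) = cong₂ _,_ (identity x y) (identity x′ y′)
  where identity : ∀ x y → - (x - y) ≡ y - x
        identity = solve-∀

module LinearForms (α : IrrationalReal) where

  lt-consistent : ∀ {q} → lt α q ≡ true → lt α q ≡ false → ⊥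
  lt-consistent αq αq′ with () ← trans (sym αq) αq′

  lt-upClosed : ∀ p q → p ℚ.≤ q → lt α p ≡ false → lt α q ≡ false
  lt-upClosed p q p≤q αp with lt α q in αq
  ... | false = refl
  ... | true = ⊥-elim (lt-consistent (downClosed α p q p≤q αq) αp)

  below≤above : ∀ p q m n → lt α (p / suc m) ≡ true → lt α (q / suc n) ≡ false →
                p * + suc n ℤ.≤ q * + suc m
  below≤above p q m n αp αq with ℤ.≤-total (p * + suc n) (q * + suc m)
  ... | inj₁ le = le
  ... | inj₂ ge = ⊥-elim (lt-consistent αp (lt-upClosed _ _ (*≤*⇒/≤/ q p n m ge) αq))

  Pos-+-comm : ∀ x y x′ y′ → Pos α (x + x′) (y + y′) → Pos α (x′ + x) (y′ + y)
  Pos-+-comm x y x′ y′ = subst₂ (Pos α) (ℤ.+-comm x x′) (ℤ.+-comm y y′)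

  private
    Pos-+-0ˡ : ∀ y x y′ → Pos α 0ℤ y → Pos α x y′ → Pos α (0ℤ + x) (y + y′)
    Pos-+-0ˡ y (+ 0) y′ y>0 y′>0 = ℤ.+-mono-< y>0 y′>0
    Pos-+-0ˡ y +[1+ n ] y′ y>0 α>-y′ =
      downClosed α _ _ (*≤*⇒/≤/ (- (y + y′)) (- y′) n n
        (ℤ.*-monoʳ-≤-nonNeg +[1+ n ] (≤-from-≡-diff (- (y + y′)) (- y′) (ℤ.<⇒≤ y>0) (identity y y′)))) α>-y′
      where identity : ∀ y y′ → (- y′) - (- (y + y′)) ≡ y - 0ℤ
            identity = solve-∀
    Pos-+-0ˡ y -[1+ n ] y′ y>0 α<y′ =
      lt-upClosed _ _ (*≤*⇒/≤/ y′ (y + y′) n n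
        (ℤ.*-monoʳ-≤-nonNeg +[1+ n ] (≤-from-≡-diff y′ (y + y′) (ℤ.<⇒≤ y>0) (identity y y′)))) α<y′
      where identity : ∀ y y′ → (y + y′) - y′ ≡ y - 0ℤ
            identity = solve-∀

    -- -y′/(m+1) is the larger lower bound for α, so it dominates the mediant.
    Pos-+-pos : ∀ n y m y′ → (- y) * + suc m ℤ.≤ (- y′) * + suc n →
                Pos α +[1+ m ] y′ → Pos α (+[1+ n ] + +[1+ m ]) (y + y′)
    Pos-+-pos n y m y′ le α>-y′ = downClosed α _ _ (*≤*⇒/≤/ (- (y + y′)) (- y′) (n ℕ.+ suc m) m
      (subst (λ x → x * + suc m ℤ.≤ (- y′) * (+ suc n + + suc m)) (sym (ℤ.neg-distrib-+ y y′))
        (mediant-≤ʳ (- y) (+ suc n) (- y′) (+ suc m) le))) α>-y′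

    Pos-+-neg : ∀ n y m y′ → y * + suc m ℤ.≤ y′ * + suc n →
                Pos α -[1+ n ] y → Pos α (-[1+ n ] + -[1+ m ]) (y + y′)
    Pos-+-neg n y m y′ le α<y = lt-upClosed _ _ (*≤*⇒/≤/ y (y + y′) n (suc (n ℕ.+ m))
      (subst (λ x → y * x ℤ.≤ (y + y′) * + suc n) denominator
        (mediant-≥ˡ y (+ suc n) y′ (+ suc m) le))) α<y
      where denominator : + suc n + + suc m ≡ + suc (suc (n ℕ.+ m))
            denominator = cong (λ k → + suc k) (ℕ.+-suc n m)

    Pos-+-cancel : ∀ n y m y′ → Pos α +[1+ n ] y → Pos α -[1+ m ] y′ → n ≡ m → 0ℤ ℤ.< y + y′
    Pos-+-cancel n y .n y′ α>-y α<y′ refl = ℤ.≰⇒> λ y+y′≤0 →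
      lt-consistent (downClosed α _ _ (*≤*⇒/≤/ y′ (- y) n n (y′≤-y y+y′≤0)) α>-y) α<y′
      where
      y′≤-y : y + y′ ℤ.≤ 0ℤ → y′ * + suc n ℤ.≤ (- y) * + suc n
      y′≤-y le = ℤ.*-monoʳ-≤-nonNeg +[1+ n ] (≤-from-≡-diff y′ (- y) le (identity y y′))
        where identity : ∀ y y′ → (- y) - y′ ≡ 0ℤ - (y + y′)
              identity = solve-∀

    -- -y/(n+1) is the mediant of -(y+y′)/(k+1) and y′/(m+1), and lies below the latter.
    Pos-+-pos-wins : ∀ n y m y′ k → Pos α +[1+ n ] y → Pos α -[1+ m ] y′ →
                     + suc n ≡ + suc k + + suc m → Pos α +[1+ k ] (y + y′)
    Pos-+-pos-wins n y m y′ k α>-y α<y′ n+1 = downClosed α _ _ (*≤*⇒/≤/ P (- y) k n step₃) α>-y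
      where
      P : ℤ
      P = - (y + y′)
      P+y′ : P + y′ ≡ - y
      P+y′ = identity y y′
        where identity : ∀ y y′ → - (y + y′) + y′ ≡ - y
              identity = solve-∀
      step₁ : (P + y′) * + suc m ℤ.≤ y′ * (+ suc k + + suc m)
      step₁ = subst₂ (λ u w → u * + suc m ℤ.≤ y′ * w) (sym P+y′) n+1
                (below≤above (- y) y′ n m α>-y α<y′)
      step₂ : P * (+ suc k + + suc m) ℤ.≤ (P + y′) * + suc k
      step₂ = mediant-≥ˡ P (+ suc k) y′ (+ suc m) (mediant-≤ʳ⁻¹ P (+ suc k) y′ (+ suc m) step₁)
      step₃ : P * + suc n ℤ.≤ (- y) * + suc k
      step₃ = subst₂ (λ u w → P * u ℤ.≤ w * + suc k) (sym n+1) P+y′ step₂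

    -- y′/(m+1) is the mediant of -y/(n+1) and (y+y′)/(k+1), and lies above the former.
    Pos-+-neg-wins : ∀ n y m y′ k → Pos α +[1+ n ] y → Pos α -[1+ m ] y′ →
                     + suc m ≡ + suc n + + suc k → Pos α -[1+ k ] (y + y′)
    Pos-+-neg-wins n y m y′ k α>-y α<y′ m+1 = lt-upClosed _ _ (*≤*⇒/≤/ y′ P m k step₃) α<y′
      where
      P : ℤ
      P = y + y′
      -y+P : - y + P ≡ y′
      -y+P = identity y y′
        where identity : ∀ y y′ → - y + (y + y′) ≡ y′
              identity = solve-∀
      step₁ : (- y) * (+ suc n + + suc k) ℤ.≤ (- y + P) * + suc n
      step₁ = subst₂ (λ u w → (- y) * u ℤ.≤ w * + suc n) m+1 (sym -y+P)
                (below≤above (- y) y′ n m α>-y α<y′)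
      step₂ : (- y + P) * + suc k ℤ.≤ P * (+ suc n + + suc k)
      step₂ = mediant-≤ʳ (- y) (+ suc n) P (+ suc k) (mediant-≥ˡ⁻¹ (- y) (+ suc n) P (+ suc k) step₁)
      step₃ : y′ * + suc k ℤ.≤ P * + suc m
      step₃ = subst₂ (λ u w → u * + suc k ℤ.≤ P * w) -y+P (sym m+1) step₂

    Pos-+-mixed : ∀ n y m y′ → Pos α +[1+ n ] y → Pos α -[1+ m ] y′ →
                  Pos α (+[1+ n ] + -[1+ m ]) (y + y′)
    Pos-+-mixed n y m y′ α>-y α<y′ with +[1+ n ] + -[1+ m ] in eq
    ... | + 0 = Pos-+-cancel n y m y′ α>-y α<y′
                  (ℕ.suc-injective (ℤ.+-injective
                    (trans (sub-add (+ suc n) (+ suc m)) (cong (_+ + suc m) eq))))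
    ... | +[1+ k ] = Pos-+-pos-wins n y m y′ k α>-y α<y′
                       (trans (sub-add (+ suc n) (+ suc m)) (cong (_+ + suc m) eq))
    ... | -[1+ k ] = Pos-+-neg-wins n y m y′ k α>-y α<y′
                       (trans (sub-sub (+ suc n) (+ suc m)) (cong (λ x → + suc n + - x) eq))

  Pos-+ : ∀ x y x′ y′ → Pos α x y → Pos α x′ y′ → Pos α (x + x′) (y + y′)
  Pos-+ (+ 0)    y x′ y′ h h′ = Pos-+-0ˡ y x′ y′ h h′
  Pos-+ +[1+ n ] y (+ 0) y′ h h′ = Pos-+-comm (+ 0) y′ +[1+ n ] y (Pos-+-0ˡ y′ +[1+ n ] y h′ h)
  Pos-+ -[1+ n ] y (+ 0) y′ h h′ = Pos-+-comm (+ 0) y′ -[1+ n ] y (Pos-+-0ˡ y′ -[1+ n ] y h′ h)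
  Pos-+ +[1+ n ] y +[1+ m ] y′ h h′ with ℤ.≤-total ((- y) * + suc m) ((- y′) * + suc n)
  ... | inj₁ le = Pos-+-pos n y m y′ le h′
  ... | inj₂ ge = Pos-+-comm +[1+ m ] y′ +[1+ n ] y (Pos-+-pos m y′ n y ge h)
  Pos-+ -[1+ n ] y -[1+ m ] y′ h h′ with ℤ.≤-total (y * + suc m) (y′ * + suc n)
  ... | inj₁ le = Pos-+-neg n y m y′ le h
  ... | inj₂ ge = Pos-+-comm -[1+ m ] y′ -[1+ n ] y (Pos-+-neg m y′ n y ge h′)
  Pos-+ +[1+ n ] y -[1+ m ] y′ h h′ = Pos-+-mixed n y m y′ h h′
  Pos-+ -[1+ n ] y +[1+ m ] y′ h h′ = Pos-+-comm +[1+ m ] y′ -[1+ n ] y (Pos-+-mixed m y′ n y h′ h)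

  Pos-irrefl : ¬ Pos α 0ℤ 0ℤ
  Pos-irrefl = ℤ.<-irrefl refl

  Pos-trichotomy : ∀ x y → Pos α x y ⊎ (x ≡ 0ℤ × y ≡ 0ℤ) ⊎ Pos α (- x) (- y)
  Pos-trichotomy (+ 0) y with ℤ.<-cmp 0ℤ y
  ... | tri< y>0 _ _ = inj₁ y>0
  ... | tri≈ _ y≡0 _ = inj₂ (inj₁ (refl , sym y≡0))
  ... | tri> _ _ y<0 = inj₂ (inj₂ (ℤ.neg-mono-< y<0))
  Pos-trichotomy +[1+ n ] y with lt α ((- y) / suc n) in αy
  ... | true  = inj₁ refl
  ... | false = inj₂ (inj₂ refl)
  Pos-trichotomy -[1+ n ] y with lt α (y / suc n) in αy
  ... | false = inj₁ refl
  ... | true  = inj₂ (inj₂ (subst (λ z → lt α (z / suc n) ≡ true) (sym (ℤ.neg-involutive y)) αy))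

  Positive : Lin → Set
  Positive (x , y) = Pos α x y

  Positive-⊕ : ∀ X Y → Positive X → Positive Y → Positive (X ⊕ Y)
  Positive-⊕ (x , y) (x′ , y′) = Pos-+ x y x′ y′

  NonNegative : Lin → Set
  NonNegative X = Positive X ⊎ X ≡ 0ᴸ

  Positive-⊕-NonNegative : ∀ X Y → Positive X → NonNegative Y → Positive (X ⊕ Y)
  Positive-⊕-NonNegative X Y X>0 (inj₁ Y>0) = Positive-⊕ X Y X>0 Y>0
  Positive-⊕-NonNegative X _ X>0 (inj₂ refl) = subst Positive (sym (⊕-identityʳ X)) X>0

  infix 4 _≺_ _≼_

  -- A record rather than Positive (Y ⊖ X) itself, so that X and Y can be
  -- inferred from a proof of X ≺ Y.
  record _≺_ (X Y : Lin) : Set where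
    constructor ≺⁺
    field positive : Positive (Y ⊖ X)
  open _≺_ public

  _≼_ : Lin → Lin → Set
  X ≼ Y = X ≺ Y ⊎ X ≡ Y

  ≺-irrefl : Irreflexive _≡_ _≺_
  ≺-irrefl {X} refl (≺⁺ X<X) = Pos-irrefl (subst Positive (⊖-self X) X<X)

  ≺-trans : Transitive _≺_
  ≺-trans {X} {Y} {Z} (≺⁺ X<Y) (≺⁺ Y<Z) =
    ≺⁺ (subst Positive (⊖-telescope X Y Z) (Positive-⊕ (Y ⊖ X) (Z ⊖ Y) X<Y Y<Z))

  ≺-asym : Asymmetric _≺_
  ≺-asym X<Y Y<X = ≺-irrefl refl (≺-trans X<Y Y<X)

  ≺-cmp : Trichotomous _≡_ _≺_
  ≺-cmp X@(x , x′) Y@(y , y′) with Pos-trichotomy (y - x) (y′ - x′)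
  ... | inj₁ X<Y = tri< (≺⁺ X<Y) (λ X≡Y → ≺-irrefl X≡Y (≺⁺ X<Y)) (≺-asym (≺⁺ X<Y))
  ... | inj₂ (inj₁ (d≡0 , d′≡0)) = tri≈ (≺-irrefl X≡Y) X≡Y (≺-irrefl (sym X≡Y))
    where X≡Y : X ≡ Y
          X≡Y = sym (cong₂ _,_ (ℤ.i-j≡0⇒i≡j y x d≡0) (ℤ.i-j≡0⇒i≡j y′ x′ d′≡0))
  ... | inj₂ (inj₂ Y<X) = tri> (≺-asym (≺⁺ Y<X′)) (λ X≡Y → ≺-irrefl (sym X≡Y) (≺⁺ Y<X′)) (≺⁺ Y<X′)
    where Y<X′ : Positive (X ⊖ Y)
          Y<X′ = subst Positive (neg-⊖ Y X) Y<X

  ≼-antisym : Antisymmetric _≡_ _≼_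
  ≼-antisym = ToNonStrict.antisym _≡_ _≺_ ≡.isEquivalence ≺-trans ≺-irrefl

  ≼-trans : Transitive _≼_
  ≼-trans = ToNonStrict.trans _≡_ _≺_ ≡.isEquivalence (≡.resp₂ _≺_) ≺-trans

  ≺-≼-trans : Trans _≺_ _≼_ _≺_
  ≺-≼-trans = ToNonStrict.<-≤-trans _≡_ _≺_ ≺-trans (proj₁ (≡.resp₂ _≺_))

  ≺⇒⋡ : ∀ {X Y} → X ≺ Y → ¬ Y ≼ X
  ≺⇒⋡ X<Y Y≤X = ≺-irrefl refl (≺-≼-trans X<Y Y≤X)

  ≼∧≢⇒≺ : ∀ {X Y} → X ≼ Y → X ≢ Y → X ≺ Y
  ≼∧≢⇒≺ (inj₁ X<Y) _   = X<Y
  ≼∧≢⇒≺ (inj₂ X≡Y) X≢Y = ⊥-elim (X≢Y X≡Y)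

  ≼⇒NonNegative : ∀ {X Y} → X ≼ Y → NonNegative (Y ⊖ X)
  ≼⇒NonNegative (inj₁ (≺⁺ X<Y)) = inj₁ X<Y
  ≼⇒NonNegative {X} (inj₂ refl) = inj₂ (⊖-self X)

  NonNegative⇒≼ : ∀ {X Y} → NonNegative (Y ⊖ X) → X ≼ Y
  NonNegative⇒≼ (inj₁ X<Y) = inj₁ (≺⁺ X<Y)
  NonNegative⇒≼ {x , x′} {y , y′} (inj₂ d≡0) =
    inj₂ (sym (cong₂ _,_ (ℤ.i-j≡0⇒i≡j y x (cong proj₁ d≡0)) (ℤ.i-j≡0⇒i≡j y′ x′ (cong proj₂ d≡0))))

  Positive⇒0≺ : ∀ X → Positive X → 0ᴸ ≺ X
  Positive⇒0≺ X X>0 = ≺⁺ (subst Positive (sym (⊖-identityʳ X)) X>0)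

  0≺⇒Positive : ∀ {X} → 0ᴸ ≺ X → Positive X
  0≺⇒Positive {X} (≺⁺ X>0) = subst Positive (⊖-identityʳ X) X>0

  0≼⇒NonNegative : ∀ {X} → 0ᴸ ≼ X → NonNegative X
  0≼⇒NonNegative {X} 0≤X = subst NonNegative (⊖-identityʳ X) (≼⇒NonNegative 0≤X)

  0≼-⊕ : ∀ {X Y} → 0ᴸ ≼ X → 0ᴸ ≼ Y → 0ᴸ ≼ X ⊕ Y
  0≼-⊕ {X} {Y} (inj₁ 0<X) 0≤Y =
    inj₁ (Positive⇒0≺ (X ⊕ Y) (Positive-⊕-NonNegative X Y (0≺⇒Positive 0<X) (0≼⇒NonNegative 0≤Y)))
  0≼-⊕ {Y = Y} (inj₂ refl) 0≤Y = subst (0ᴸ ≼_) (sym (⊕-identityˡ Y)) 0≤Y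

  ⊖-monoˡ-≼ : ∀ {X Y} Z → X ≼ Y → X ⊖ Z ≼ Y ⊖ Z
  ⊖-monoˡ-≼ {X} {Y} Z X≤Y = NonNegative⇒≼ (subst NonNegative (sym (⊖-⊖-cancelʳ X Y Z)) (≼⇒NonNegative X≤Y))

  ≼-⊕ʳ : ∀ X {Y} → 0ᴸ ≼ Y → X ≼ X ⊕ Y
  ≼-⊕ʳ X {Y} 0≤Y = NonNegative⇒≼ (subst NonNegative (sym (⊕-⊖-cancelˡ X Y)) (0≼⇒NonNegative 0≤Y))

  InUnit : Lin → Set
  InUnit X = 0ᴸ ≼ X × X ≺ 1ᴸ

  InUnit-⊖ : ∀ {X Y} → InUnit X → InUnit Y → X ≺ Y → InUnit (Y ⊖ X)
  InUnit-⊖ {X} {Y} (0≤X , _) (_ , ≺⁺ Y<1) (≺⁺ X<Y) =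
    inj₁ (Positive⇒0≺ (Y ⊖ X) X<Y) ,
    ≺⁺ (subst Positive (sym (⊖-⊖ 1ᴸ Y X))
         (Positive-⊕-NonNegative (1ᴸ ⊖ Y) X Y<1 (0≼⇒NonNegative 0≤X)))

  InUnit-⊕ : ∀ {X Y} → 0ᴸ ≼ X → 0ᴸ ≼ Y → X ⊕ Y ≺ 1ᴸ → InUnit (X ⊕ Y)
  InUnit-⊕ 0≤X 0≤Y X+Y<1 = 0≼-⊕ 0≤X 0≤Y , X+Y<1

  InUnit-no-gap : ∀ {X Y} → InUnit X → InUnit Y → proj₁ X ≡ proj₁ Y → ¬ X ≺ Y
  InUnit-no-gap {x , x′} {.x , y′} (0≤X , _) (_ , ≺⁺ Y<1) refl (≺⁺ X<Y) =
    positive-sum≢1 (subst (λ i → Pos α i (y′ - x′)) (ℤ.+-inverseʳ x) X<Y)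
                   (subst (λ i → Pos α i ((+ 1 - y′) + x′)) (cancel x) 1-Y+X>0)
                   (sum≡1 x′ y′)
    where
    1-Y+X>0 : Positive ((1ᴸ ⊖ (x , y′)) ⊕ (x , x′))
    1-Y+X>0 = Positive-⊕-NonNegative (1ᴸ ⊖ (x , y′)) (x , x′) Y<1 (0≼⇒NonNegative 0≤X)
    cancel : ∀ x → (0ℤ - x) + x ≡ 0ℤ
    cancel = solve-∀
    sum≡1 : ∀ x′ y′ → (y′ - x′) + ((+ 1 - y′) + x′) ≡ + 1
    sum≡1 = solve-∀

  -- Two points of [0,1) with the same α-coefficient differ by an integer
  -- of absolute value < 1.
  InUnit-unique : ∀ {X Y} → InUnit X → InUnit Y → proj₁ X ≡ proj₁ Y → X ≡ Y
  InUnit-unique {X} {Y} X∈ Y∈ eq with ≺-cmp X Y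
  ... | tri< X<Y _ _ = ⊥-elim (InUnit-no-gap X∈ Y∈ eq X<Y)
  ... | tri≈ _ X≡Y _ = X≡Y
  ... | tri> _ _ Y<X = ⊥-elim (InUnit-no-gap Y∈ X∈ (sym eq) Y<X)

module ThreeGap (α : IrrationalReal) (fl : ℕ → ℤ) (isFloor : IsFloor α fl) where
  open LinearForms α

  fr : ℕ → Lin
  fr = frac fl

  cofr : ℕ → Lin
  cofr m = 1ᴸ ⊖ fr m

  fr-InUnit : ∀ m → InUnit (fr m)
  fr-InUnit m = map₁ ≺⁺ (proj₁ (isFloor m)) , ≺⁺ (proj₂ (isFloor m))

  fr-injective : ∀ {m n} → fr m ≡ fr n → m ≡ n
  fr-injective eq = ℤ.+-injective (cong proj₁ eq)

  0≺fr : ∀ {m} → m ≢ 0 → 0ᴸ ≺ fr m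
  0≺fr {m} m≢0 with proj₁ (fr-InUnit m)
  ... | inj₁ 0<fr = 0<fr
  ... | inj₂ 0≡fr = ⊥-elim (m≢0 (sym (ℤ.+-injective (cong proj₁ 0≡fr))))

  0≺cofr : ∀ m → 0ᴸ ≺ cofr m
  0≺cofr m = Positive⇒0≺ _ (positive (proj₂ (fr-InUnit m)))

  cofr-InUnit : ∀ {m} → m ≢ 0 → InUnit (cofr m)
  cofr-InUnit {m} m≢0 =
    inj₁ (0≺cofr m) , ≺⁺ (subst Positive (sym (⊖-⊖-cancel 1ᴸ (fr m))) (0≺⇒Positive (0≺fr m≢0)))

  cofr-injective : ∀ {m n} → cofr m ≡ cofr n → m ≡ n
  cofr-injective {m} {n} eq =
    fr-injective (trans (sym (⊖-⊖-cancel 1ᴸ (fr m))) (trans (cong (1ᴸ ⊖_) eq) (⊖-⊖-cancel 1ᴸ (fr n))))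

  cofr≢fr : ∀ {m n} → 0 < m → cofr m ≢ fr n
  cofr≢fr {suc _} _ eq with () ← cong proj₁ eq

  cofr-antitone : ∀ {m n} → fr m ≼ fr n → cofr n ≼ cofr m
  cofr-antitone {m} {n} fm≤fn =
    NonNegative⇒≼ (subst NonNegative (sym (⊖-⊖-cancelˡ 1ᴸ (fr m) (fr n))) (≼⇒NonNegative fm≤fn))

  fr-0 : fr 0 ≡ 0ᴸ
  fr-0 = InUnit-unique (fr-InUnit 0) (inj₂ refl , ≺⁺ (ℤ.+<+ ℕ.z<s)) refl

  InUnit⇒fr : ∀ {X} d → InUnit X → proj₁ X ≡ + d → X ≡ fr d
  InUnit⇒fr d X∈ eq = InUnit-unique X∈ (fr-InUnit d) eq

  InUnit⇒cofr : ∀ {X} e → InUnit X → proj₁ X ≡ -[1+ e ] → X ≡ cofr (suc e)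
  InUnit⇒cofr e X∈ eq = InUnit-unique X∈ (cofr-InUnit {suc e} (λ ())) eq

  fr-+-wrap : ∀ e d → cofr (suc d) ≺ fr e → fr (suc d ℕ.+ e) ≺ fr e
  fr-+-wrap e d cofr<fr = subst (_≺ fr e) (sym fr≡X) X<fr
    where
    X : Lin
    X = fr e ⊖ cofr (suc d)
    X<fr : X ≺ fr e
    X<fr = ≺⁺ (subst Positive (sym (⊖-⊖-cancel (fr e) (cofr (suc d)))) (0≺⇒Positive (0≺cofr (suc d))))
    coefficient : + e - (0ℤ - + suc d) ≡ + (suc d ℕ.+ e)
    coefficient = trans (identity (+ e) (+ suc d)) (sym (ℤ.pos-+ (suc d) e))
      where identity : ∀ x y → x - (0ℤ - y) ≡ y + x
            identity = solve-∀
    fr≡X : fr (suc d ℕ.+ e) ≡ X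
    fr≡X = sym (InUnit⇒fr (suc d ℕ.+ e) (InUnit-⊖ (cofr-InUnit (λ ())) (fr-InUnit e) cofr<fr) coefficient)

  fr-+-nowrap : ∀ e d → fr (suc d) ≺ cofr e → fr e ≺ fr (suc d ℕ.+ e)
  fr-+-nowrap e d fr<cofr = subst (fr e ≺_) (sym fr≡X) fr<X
    where
    X : Lin
    X = fr e ⊕ fr (suc d)
    fr<X : fr e ≺ X
    fr<X = ≺⁺ (subst Positive (sym (⊕-⊖-cancelˡ (fr e) (fr (suc d)))) (0≺⇒Positive (0≺fr {suc d} (λ ()))))
    X<1 : X ≺ 1ᴸ
    X<1 = ≺⁺ (subst Positive (⊖-⊕ 1ᴸ (fr e) (fr (suc d))) (positive fr<cofr))
    fr≡X : fr (suc d ℕ.+ e) ≡ X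
    fr≡X = sym (InUnit⇒fr (suc d ℕ.+ e) (InUnit-⊕ (proj₁ (fr-InUnit e)) (inj₁ (0≺fr {suc d} (λ ()))) X<1)
                          (cong +_ (ℕ.+-comm e (suc d))))

  distance-up : ∀ {m t X} → fr m ≺ fr t → InUnit X → proj₁ X ≡ + t - + m → X ≡ fr t ⊖ fr m
  distance-up {m} {t} fm<ft X∈ eq = InUnit-unique X∈ (InUnit-⊖ (fr-InUnit m) (fr-InUnit t) fm<ft) eq

  distance-wrap : ∀ {m t X} → fr t ≺ fr m → InUnit X → proj₁ X ≡ + t - + m → X ≡ cofr m ⊕ fr t
  distance-wrap {m} {t} ft<fm X∈ eq = InUnit-unique X∈ Y∈ (trans eq (identity (+ t) (+ m)))
    where
    Y∈ : InUnit (cofr m ⊕ fr t)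
    Y∈ = InUnit-⊕ (inj₁ (0≺cofr m)) (proj₁ (fr-InUnit t))
                  (≺⁺ (subst Positive (sym (⊖-⊕-⊖ˡ 1ᴸ (fr m) (fr t))) (positive ft<fm)))
    identity : ∀ t m → t - m ≡ (0ℤ - m) + t
    identity = solve-∀

  -- Moving up from {mα} on the circle ℝ/ℤ, the first of the points {tα},
  -- t < N, is {m′α}, at distance g: a point X ∈ [0,1) with α-coefficient
  -- t - m is the distance from {mα} up to {tα}.
  record IsNextGap (N m m′ : ℕ) (g : Lin) : Set where
    field
      m<N           : m < N
      m′<N          : m′ < N
      m′≢m          : m′ ≢ m
      g∈            : InUnit g
      g-coefficient : proj₁ g ≡ + m′ - + m
      minimal       : ∀ {t X} → t < N → t ≢ m → InUnit X → proj₁ X ≡ + t - + m → g ≼ X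

  data Shift (m m′ : ℕ) (g : Lin) : Set where
    up   : ∀ e → m′ ≡ suc e ℕ.+ m → g ≡ fr (suc e)   → Shift m m′ g
    down : ∀ e → m ≡ suc e ℕ.+ m′ → g ≡ cofr (suc e) → Shift m m′ g

  shift : ∀ {N m m′ g} → IsNextGap N m m′ g → Shift m m′ g
  shift {m = m} {m′} next with ℕ.<-cmp m m′
  ... | tri< m<m′ _ _ = up e m′≡ (InUnit⇒fr (suc e) g∈
          (trans g-coefficient (trans (cong (λ k → + k - + m) m′≡) (+[d+m]-+m (suc e) m))))
    where
    open IsNextGap next
    e : ℕ
    e = m′ ℕ.∸ suc m
    m′≡ : m′ ≡ suc e ℕ.+ m
    m′≡ = trans (sym (ℕ.m∸n+n≡m m<m′)) (ℕ.+-suc e m)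
  ... | tri≈ _ m≡m′ _ = ⊥-elim (IsNextGap.m′≢m next (sym m≡m′))
  ... | tri> _ _ m′<m = down e m≡ (InUnit⇒cofr e g∈
          (trans g-coefficient (trans (cong (λ k → + m′ - + k) m≡) (+m-+[d+m] (suc e) m′))))
    where
    open IsNextGap next
    e : ℕ
    e = m ℕ.∸ suc m′
    m≡ : m ≡ suc e ℕ.+ m′
    m≡ = trans (sym (ℕ.m∸n+n≡m m′<m)) (ℕ.+-suc e m′)

  module _ {N m m′ g} (next : IsNextGap N m m′ g) where
    open IsNextGap next

    next-≼-fr : ∀ {d} → 0 < d → d ℕ.+ m < N → g ≼ fr d
    next-≼-fr {d} 0<d d+m<N = minimal d+m<N d+m≢m (fr-InUnit d) (sym (+[d+m]-+m d m))
      where d+m≢m : d ℕ.+ m ≢ m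
            d+m≢m eq = ℕ.n>0⇒n≢0 0<d (ℕ.+-cancelʳ-≡ m d 0 eq)

    next-≼-cofr : ∀ {d w} → 0 < d → m ≡ d ℕ.+ w → g ≼ cofr d
    next-≼-cofr {d} {w} 0<d refl = minimal w<N w≢m (cofr-InUnit (ℕ.n>0⇒n≢0 0<d)) coefficient
      where
      w<N : w < N
      w<N = ℕ.≤-<-trans (ℕ.m≤n+m w d) m<N
      w≢m : w ≢ d ℕ.+ w
      w≢m eq = ℕ.n>0⇒n≢0 0<d (sym (ℕ.+-cancelʳ-≡ w 0 d eq))
      coefficient : 0ℤ - + d ≡ + w - + (d ℕ.+ w)
      coefficient = trans (ℤ.+-identityˡ (- + d)) (sym (+m-+[d+m] d w))

  module Rules {N u v : ℕ} (0<u : 0 < u) (u<N : u < N) (0<v : 0 < v) (v<N : v < N)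
               (u-min : ∀ {d} → 0 < d → d < N → fr u ≼ fr d)
               (v-max : ∀ {d} → 0 < d → d < N → fr d ≼ fr v) where

    rule-A : ∀ {m m′ g} → IsNextGap N m m′ g → u ℕ.+ m < N → m′ ≡ u ℕ.+ m × g ≡ fr u
    rule-A {m} {g = g} next u+m<N with shift next
    ... | up e m′≡ g≡ = trans m′≡ (cong (ℕ._+ m) e≡u) , g≡fr
      where
      e<N : suc e < N
      e<N = ℕ.≤-<-trans (ℕ.m≤m+n (suc e) m) (subst (_< N) m′≡ (IsNextGap.m′<N next))
      g≡fr : g ≡ fr u
      g≡fr = ≼-antisym (next-≼-fr next 0<u u+m<N) (subst (fr u ≼_) (sym g≡) (u-min ℕ.z<s e<N))
      e≡u : suc e ≡ u
      e≡u = fr-injective (trans (sym g≡) g≡fr)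
    ... | down e m≡ g≡ = ⊥-elim (≺⇒⋡ (fr-+-wrap u e cofr<fr) (u-min ℕ.z<s e+u<N))
      where
      cofr<fr : cofr (suc e) ≺ fr u
      cofr<fr = subst (_≺ fr u) g≡
        (≼∧≢⇒≺ (next-≼-fr next 0<u u+m<N) (λ g≡fr → cofr≢fr ℕ.z<s (trans (sym g≡) g≡fr)))
      e+u<N : suc e ℕ.+ u < N
      e+u<N = ℕ.≤-<-trans (subst (suc e ℕ.+ u ℕ.≤_) (ℕ.+-comm m u)
                (ℕ.+-monoˡ-≤ u (subst (suc e ℕ.≤_) (sym m≡) (ℕ.m≤m+n (suc e) _)))) u+m<N

    rule-B : ∀ {m m′ g} → IsNextGap N m m′ g → v ℕ.≤ m → m ≡ v ℕ.+ m′ × g ≡ cofr v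
    rule-B {m} {m′} {g} next v≤m with shift next
    ... | down e m≡ g≡ = trans m≡ (cong (ℕ._+ m′) e≡v) , g≡cofr
      where
      e<N : suc e < N
      e<N = ℕ.≤-<-trans (subst (suc e ℕ.≤_) (sym m≡) (ℕ.m≤m+n (suc e) m′)) (IsNextGap.m<N next)
      g≡cofr : g ≡ cofr v
      g≡cofr = ≼-antisym (next-≼-cofr next 0<v (sym (ℕ.m+[n∸m]≡n v≤m)))
                         (subst (cofr v ≼_) (sym g≡) (cofr-antitone (v-max ℕ.z<s e<N)))
      e≡v : suc e ≡ v
      e≡v = cofr-injective (trans (sym g≡) g≡cofr)
    ... | up e m′≡ g≡ = ⊥-elim (≺⇒⋡ (fr-+-nowrap v e fr<cofr) (v-max ℕ.z<s e+v<N))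
      where
      fr<cofr : fr (suc e) ≺ cofr v
      fr<cofr = subst (_≺ cofr v) g≡
        (≼∧≢⇒≺ (next-≼-cofr next 0<v (sym (ℕ.m+[n∸m]≡n v≤m)))
               (λ g≡cofr → cofr≢fr 0<v (trans (sym g≡cofr) g≡)))
      e+v<N : suc e ℕ.+ v < N
      e+v<N = ℕ.≤-<-trans (subst (suc e ℕ.+ v ℕ.≤_) (sym m′≡) (ℕ.+-monoʳ-≤ (suc e) v≤m))
                (IsNextGap.m′<N next)

    wide : Lin
    wide = fr u ⊕ cofr v

    wide-InUnit : u ≢ v → InUnit wide
    wide-InUnit u≢v = InUnit-⊕ (proj₁ (fr-InUnit u)) (inj₁ (0≺cofr v))
      (≺⁺ (subst Positive (sym (⊖-⊕-⊖ʳ 1ᴸ (fr u) (fr v))) (positive fru<frv)))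
      where fru<frv : fr u ≺ fr v
            fru<frv = ≼∧≢⇒≺ (v-max 0<u u<N) (λ eq → u≢v (fr-injective eq))

    module _ {m m′ g} (next : IsNextGap N m m′ g) (N≤u+m : N ℕ.≤ u ℕ.+ m) (m<v : m < v) where
      open IsNextGap next

      next-≼-wide : u ≢ v → g ≼ wide
      next-≼-wide u≢v = minimal t<N t≢m (wide-InUnit u≢v) coefficient
        where
        t : ℕ
        t = (u ℕ.+ m) ℕ.∸ v
        t+v≡u+m : t ℕ.+ v ≡ u ℕ.+ m
        t+v≡u+m = ℕ.m∸n+n≡m (ℕ.≤-trans (ℕ.<⇒≤ v<N) N≤u+m)
        t<N : t < N
        t<N = ℕ.<-trans (ℕ.+-cancelʳ-< v t u (subst (_< u ℕ.+ v) (sym t+v≡u+m) (ℕ.+-monoʳ-< u m<v))) u<N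
        t≢m : t ≢ m
        t≢m t≡m = u≢v (sym (ℕ.+-cancelˡ-≡ m v u
                          (trans (cong (ℕ._+ v) (sym t≡m)) (trans t+v≡u+m (ℕ.+-comm u m)))))
        coefficient : + u + (0ℤ - + v) ≡ + t - + m
        coefficient = trans (cong (λ x → + u + x) (ℤ.+-identityˡ (- + v)))
                            (sym (i+l≡k+j⇒i-j≡k-l (+ t) (+ m) (+ u) (+ v) (cong +_ t+v≡u+m)))

      wide-≼-up : ∀ e → m′ ≡ suc e ℕ.+ m → g ≡ fr (suc e) → wide ≼ g
      wide-≼-up e m′≡ g≡ = NonNegative⇒≼ (subst NonNegative difference (≼⇒NonNegative cofr-v≤cofr-k))
        where
        d<u : suc e < u
        d<u = ℕ.+-cancelʳ-< m (suc e) u (ℕ.<-≤-trans (subst (_< N) m′≡ m′<N) N≤u+m)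
        k : ℕ
        k = u ℕ.∸ suc (suc e)
        u≡ : u ≡ suc k ℕ.+ suc e
        u≡ = trans (sym (ℕ.m∸n+n≡m d<u)) (ℕ.+-suc k (suc e))
        fru<frd : fr u ≺ fr (suc e)
        fru<frd = ≼∧≢⇒≺ (u-min ℕ.z<s (ℕ.<-trans d<u u<N)) (λ eq → ℕ.<⇒≢ d<u (sym (fr-injective eq)))
        frd-fru≡cofr : fr (suc e) ⊖ fr u ≡ cofr (suc k)
        frd-fru≡cofr = InUnit⇒cofr k (InUnit-⊖ (fr-InUnit u) (fr-InUnit (suc e)) fru<frd)
          (trans (cong (λ j → + suc e - + j) u≡) (+m-+[d+m] (suc k) (suc e)))
        cofr-v≤cofr-k : cofr v ≼ cofr (suc k)
        cofr-v≤cofr-k = cofr-antitone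
          (v-max ℕ.z<s (ℕ.≤-<-trans (subst (suc k ℕ.≤_) (sym u≡) (ℕ.m≤m+n (suc k) (suc e))) u<N))
        difference : cofr (suc k) ⊖ cofr v ≡ g ⊖ wide
        difference = trans (cong (_⊖ cofr v) (sym frd-fru≡cofr))
                           (trans (⊖-⊕ (fr (suc e)) (fr u) (cofr v)) (cong (_⊖ wide) (sym g≡)))

      wide-≼-down : ∀ e → m ≡ suc e ℕ.+ m′ → g ≡ cofr (suc e) → wide ≼ g
      wide-≼-down e m≡ g≡ = NonNegative⇒≼ (subst NonNegative difference (≼⇒NonNegative fru≤frk))
        where
        d<v : suc e < v
        d<v = ℕ.≤-<-trans (subst (suc e ℕ.≤_) (sym m≡) (ℕ.m≤m+n (suc e) m′)) m<v
        k : ℕ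
        k = v ℕ.∸ suc (suc e)
        v≡ : v ≡ suc k ℕ.+ suc e
        v≡ = trans (sym (ℕ.m∸n+n≡m d<v)) (ℕ.+-suc k (suc e))
        frd<frv : fr (suc e) ≺ fr v
        frd<frv = ≼∧≢⇒≺ (v-max ℕ.z<s (ℕ.<-trans d<v v<N)) (λ eq → ℕ.<⇒≢ d<v (fr-injective eq))
        frv-frd≡fr : fr v ⊖ fr (suc e) ≡ fr (suc k)
        frv-frd≡fr = InUnit⇒fr (suc k) (InUnit-⊖ (fr-InUnit (suc e)) (fr-InUnit v) frd<frv)
          (trans (cong (λ j → + j - + suc e) v≡) (+[d+m]-+m (suc k) (suc e)))
        fru≤frk : fr u ≼ fr (suc k)
        fru≤frk = u-min ℕ.z<s (ℕ.≤-<-trans (subst (suc k ℕ.≤_) (sym v≡) (ℕ.m≤m+n (suc k) (suc e))) v<N)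
        difference : fr (suc k) ⊖ fr u ≡ g ⊖ wide
        difference = trans (cong (_⊖ fr u) (sym frv-frd≡fr))
                           (trans (sym (⊖-⊖-⊕-⊖ 1ᴸ (fr (suc e)) (fr u) (fr v))) (cong (_⊖ wide) (sym g≡)))

      wide-≼-next : wide ≼ g
      wide-≼-next with shift next
      ... | up e m′≡ g≡ = wide-≼-up e m′≡ g≡
      ... | down e m≡ g≡ = wide-≼-down e m≡ g≡

      rule-C : u ≢ v → m′ ℕ.+ v ≡ u ℕ.+ m × g ≡ wide
      rule-C u≢v = ℤ.+-injective (i-j≡k-l⇒i+l≡k+j (+ m′) (+ m) (+ u) (+ v) coefficient) , g≡wide
        where
        g≡wide : g ≡ wide
        g≡wide = ≼-antisym (next-≼-wide u≢v) wide-≼-next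
        coefficient : + m′ - + m ≡ + u - + v
        coefficient = trans (sym g-coefficient) (trans (cong proj₁ g≡wide)
                        (cong (λ x → + u + x) (ℤ.+-identityˡ (- + v))))

    u≢v : ∀ {m} → 1 < N → N ℕ.≤ u ℕ.+ m → m < v → u ≢ v
    u≢v {m} 1<N N≤u+m m<v refl = ℕ.<⇒≱ 1<N (subst (N ℕ.≤_) (cong₂ ℕ._+_ u≡1 m≡0) N≤u+m)
      where
      u≡1 : u ≡ 1
      u≡1 = fr-injective (≼-antisym (u-min ℕ.z<s 1<N) (v-max ℕ.z<s 1<N))
      m≡0 : m ≡ 0
      m≡0 = ℕ.n<1⇒n≡0 (subst (m <_) u≡1 m<v)

    data Kind (m m′ : ℕ) (g : Lin) : Set where
      step-u : u ℕ.+ m < N → m′ ≡ u ℕ.+ m → g ≡ fr u → Kind m m′ g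
      step-v : m ≡ v ℕ.+ m′ → g ≡ cofr v → Kind m m′ g
      step-wide : N ℕ.≤ u ℕ.+ m → m < v → m′ ℕ.+ v ≡ u ℕ.+ m → g ≡ wide → Kind m m′ g

    kind : ∀ {m m′ g} → 1 < N → IsNextGap N m m′ g → Kind m m′ g
    kind {m} 1<N next with u ℕ.+ m ℕ.<? N | v ℕ.≤? m
    ... | yes u+m<N | _     = uncurry (step-u u+m<N) (rule-A next u+m<N)
    ... | no u+m≮N  | yes v≤m = uncurry step-v (rule-B next v≤m)
    ... | no u+m≮N  | no v≰m  =
      uncurry (step-wide N≤u+m m<v) (rule-C next N≤u+m m<v (u≢v 1<N N≤u+m m<v))
      where
      N≤u+m : N ℕ.≤ u ℕ.+ m
      N≤u+m = ℕ.≮⇒≥ u+m≮N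
      m<v : m < v
      m<v = ℕ.≰⇒> v≰m

    fr-u≺wide : fr u ≺ wide
    fr-u≺wide = ≺⁺ (subst Positive (sym (⊕-⊖-cancelˡ (fr u) (cofr v))) (0≺⇒Positive (0≺cofr v)))

    cofr-v≺wide : cofr v ≺ wide
    cofr-v≺wide = ≺⁺ (subst Positive (sym (⊕-⊖-cancelʳ (fr u) (cofr v)))
                        (0≺⇒Positive (0≺fr (ℕ.n>0⇒n≢0 0<u))))

    private
      same-gap : ∀ {g g₀ X} → g ≡ X → g₀ ≡ X → ¬ g ≺ g₀
      same-gap refl refl = ≺-irrefl refl

      smaller-gap : ∀ {g g₀ X Y} → g ≡ X → g₀ ≡ Y → Y ≺ X → ¬ g ≺ g₀
      smaller-gap refl refl Y<X X<Y = ≺-asym X<Y Y<X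

      +u-sum : ∀ {L L′ R R′ s} → L ≡ u ℕ.+ L′ → R′ ≡ u ℕ.+ R → L ℕ.+ R ≡ s → L′ ℕ.+ R′ ≡ s
      +u-sum {L′ = L′} {R} refl refl refl = identity L′ u R
        where identity : ∀ a b c → a ℕ.+ (b ℕ.+ c) ≡ (b ℕ.+ a) ℕ.+ c
              identity = ℕ-Solver.solve-∀

      +v-sum : ∀ {L L′ R R′ s} → L′ ≡ v ℕ.+ L → R ≡ v ℕ.+ R′ → L ℕ.+ R ≡ s → L′ ℕ.+ R′ ≡ s
      +v-sum {L} {R′ = R′} refl refl refl = identity v L R′
        where identity : ∀ a b c → (a ℕ.+ b) ℕ.+ c ≡ b ℕ.+ (a ℕ.+ c)
              identity = ℕ-Solver.solve-∀

      -- From R to R′ the index grows by u and from L to L′ by v; both results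
      -- stay below N, yet they add up to (u + p) + (q + v) ≥ 2N.
      wide-u-v : ∀ {p q L L′ R R′} → N ℕ.≤ u ℕ.+ p → q ℕ.+ v ≡ u ℕ.+ p → u ℕ.+ R < N →
                 R′ ≡ u ℕ.+ R → L′ ≡ v ℕ.+ L → L′ < N → L ℕ.+ R ≡ p ℕ.+ q → ⊥
      wide-u-v {p} {q} {L} {R = R} N≤u+p q+v≡u+p u+R<N _ refl v+L<N L+R≡p+q =
        ℕ.<-irrefl refl (ℕ.<-≤-trans (ℕ.+-mono-< v+L<N u+R<N) N+N≤)
        where
        N+N≤ : N ℕ.+ N ℕ.≤ (v ℕ.+ L) ℕ.+ (u ℕ.+ R)
        N+N≤ = ℕ.≤-trans (ℕ.+-mono-≤ N≤u+p (subst (N ℕ.≤_) (sym q+v≡u+p) N≤u+p))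
                 (ℕ.≤-reflexive (trans (identity u p q v) (trans (cong (ℕ._+ (v ℕ.+ u)) (sym L+R≡p+q))
                                  (identity′ L R u v))))
          where identity : ∀ a b c d → (a ℕ.+ b) ℕ.+ (c ℕ.+ d) ≡ (b ℕ.+ c) ℕ.+ (d ℕ.+ a)
                identity = ℕ-Solver.solve-∀
                identity′ : ∀ a b c d → (a ℕ.+ b) ℕ.+ (d ℕ.+ c) ≡ (d ℕ.+ a) ℕ.+ (c ℕ.+ b)
                identity′ = ℕ-Solver.solve-∀

      -- From R to R′ the index drops by v and from L to L′ by u, so L + R ≥ u + v;
      -- yet p < v and q < u.
      wide-v-u : ∀ {p q L L′ R R′} → p < v → q ℕ.+ v ≡ u ℕ.+ p →
                 R ≡ v ℕ.+ R′ → L ≡ u ℕ.+ L′ → L ℕ.+ R ≡ p ℕ.+ q → ⊥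
      wide-v-u {p} {q} {L′ = L′} {R′ = R′} p<v q+v≡u+p refl refl L+R≡p+q =
        ℕ.<-irrefl refl (ℕ.<-≤-trans (ℕ.+-mono-< p<v q<u) u+v≤p+q)
        where
        q<u : q < u
        q<u = ℕ.+-cancelʳ-< v q u (subst (_< u ℕ.+ v) (sym q+v≡u+p) (ℕ.+-monoʳ-< u p<v))
        u+v≤p+q : v ℕ.+ u ℕ.≤ p ℕ.+ q
        u+v≤p+q = subst (v ℕ.+ u ℕ.≤_) L+R≡p+q
          (ℕ.≤-trans (ℕ.+-mono-≤ (ℕ.m≤m+n v R′) (ℕ.m≤m+n u L′))
                     (ℕ.≤-reflexive (identity v R′ u L′)))
          where identity : ∀ a b c d → (a ℕ.+ b) ℕ.+ (c ℕ.+ d) ≡ (c ℕ.+ d) ℕ.+ (a ℕ.+ b)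
                identity = ℕ-Solver.solve-∀

    -- p → q is the gap carrying the letter c; R → R′ and L′ → L are the gaps at
    -- the same distance to its right and to its left.
    mirror : ∀ {p q g₀ R R′ gR L′ L gL} → Kind p q g₀ →
             Kind R R′ gR → gR ≺ g₀ → Kind L′ L gL → gL ≺ g₀ → L′ < N →
             L ℕ.+ R ≡ p ℕ.+ q → L′ ℕ.+ R′ ≡ p ℕ.+ q × gL ≡ gR
    mirror (step-u _ _ e₀) (step-u _ _ eR) R< _ _ _ _ =
      ⊥-elim (same-gap eR e₀ R<)
    mirror (step-u _ _ e₀) (step-wide _ _ _ eR) R< _ _ _ _ =
      ⊥-elim (smaller-gap eR e₀ fr-u≺wide R<)
    mirror (step-u _ _ e₀) _ _ (step-u _ _ eL) L< _ _ =
      ⊥-elim (same-gap eL e₀ L<)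
    mirror (step-u _ _ e₀) _ _ (step-wide _ _ _ eL) L< _ _ =
      ⊥-elim (smaller-gap eL e₀ fr-u≺wide L<)
    mirror (step-u _ _ _) (step-v eR gR) _ (step-v eL gL) _ _ sum =
      +v-sum eL eR sum , trans gL (sym gR)
    mirror (step-v _ e₀) (step-v _ eR) R< _ _ _ _ =
      ⊥-elim (same-gap eR e₀ R<)
    mirror (step-v _ e₀) (step-wide _ _ _ eR) R< _ _ _ _ =
      ⊥-elim (smaller-gap eR e₀ cofr-v≺wide R<)
    mirror (step-v _ e₀) _ _ (step-v _ eL) L< _ _ =
      ⊥-elim (same-gap eL e₀ L<)
    mirror (step-v _ e₀) _ _ (step-wide _ _ _ eL) L< _ _ =
      ⊥-elim (smaller-gap eL e₀ cofr-v≺wide L<)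
    mirror (step-v _ _) (step-u _ eR gR) _ (step-u _ eL gL) _ _ sum =
      +u-sum eL eR sum , trans gL (sym gR)
    mirror (step-wide _ _ _ e₀) (step-wide _ _ _ eR) R< _ _ _ _ =
      ⊥-elim (same-gap eR e₀ R<)
    mirror (step-wide _ _ _ e₀) _ _ (step-wide _ _ _ eL) L< _ _ =
      ⊥-elim (same-gap eL e₀ L<)
    mirror (step-wide _ _ _ _) (step-u _ eR gR) _ (step-u _ eL gL) _ _ sum =
      +u-sum eL eR sum , trans gL (sym gR)
    mirror (step-wide _ _ _ _) (step-v eR gR) _ (step-v eL gL) _ _ sum =
      +v-sum eL eR sum , trans gL (sym gR)
    mirror (step-wide N≤u+p _ q+v≡u+p _) (step-u u+R<N eR _) _ (step-v eL _) _ L′<N sum =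
      ⊥-elim (wide-u-v N≤u+p q+v≡u+p u+R<N eR eL L′<N sum)
    mirror (step-wide _ p<v q+v≡u+p _) (step-v eR _) _ (step-u _ eL _) _ _ sum =
      ⊥-elim (wide-v-u p<v q+v≡u+p eR eL sum)

module SortedPoints (α : IrrationalReal) (fl : ℕ → ℤ) (isFloor : IsFloor α fl)
                    {N : ℕ} (1<N : 1 < N) (σ : Fin N → Fin N) (isSorting : IsSorting α fl N σ) where
  open LinearForms α
  open ThreeGap α fl isFloor

  instance
    N-nonZero : NonZero N
    N-nonZero = ℕ.>-nonZero (ℕ.<-trans ℕ.z<s 1<N)

  point : Fin N → ℕ
  point i = toℕ (σ i)

  sorted : ∀ {i j} → toℕ i < toℕ j → fr (point i) ≺ fr (point j)
  sorted = ≺⁺ ∘ isSorting _ _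

  sorted-≤ : ∀ {i j} → toℕ i ≤ toℕ j → fr (point i) ≼ fr (point j)
  sorted-≤ {i} {j} i≤j with ℕ.m≤n⇒m<n∨m≡n i≤j
  ... | inj₁ i<j = inj₁ (sorted i<j)
  ... | inj₂ i≡j = inj₂ (cong (fr ∘ point) (Fin.toℕ-injective i≡j))

  σ-injective : Injective _≡_ _≡_ σ
  σ-injective {i} {j} σi≡σj with ℕ.<-cmp (toℕ i) (toℕ j)
  ... | tri< i<j _ _ = ⊥-elim (≺-irrefl (cong (fr ∘ toℕ) σi≡σj) (sorted i<j))
  ... | tri≈ _ i≡j _ = Fin.toℕ-injective i≡j
  ... | tri> _ _ j<i = ⊥-elim (≺-irrefl (cong (fr ∘ toℕ) (sym σi≡σj)) (sorted j<i))

  point-surjective : ∀ {t} → t < N → ∃ λ i → point i ≡ t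
  point-surjective t<N with injective⇒surjective σ σ-injective (fromℕ< t<N)
  ... | i , σi≡t = i , trans (cong toℕ σi≡t) (Fin.toℕ-fromℕ< t<N)

  first : Fin N
  first = fromℕ< (ℕ.<-trans ℕ.z<s 1<N)

  point-first : point first ≡ 0
  point-first with point-surjective (ℕ.<-trans ℕ.z<s 1<N)
  ... | i , point-i≡0 with toℕ i ℕ.≟ 0
  ...   | yes i≡0 = trans (cong point (Fin.toℕ-injective (trans (Fin.toℕ-fromℕ< _) (sym i≡0)))) point-i≡0
  ...   | no i≢0 = ⊥-elim (≺⇒⋡ fr<0 (proj₁ (fr-InUnit (point first))))
    where
    fr<0 : fr (point first) ≺ 0ᴸ
    fr<0 = subst (fr (point first) ≺_) (trans (cong fr point-i≡0) fr-0)
             (sorted (subst (_< toℕ i) (sym (Fin.toℕ-fromℕ< _)) (ℕ.n≢0⇒n>0 i≢0)))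

  point≢0 : ∀ {i} → toℕ i ≢ 0 → point i ≢ 0
  point≢0 {i} i≢0 point≡0 =
    i≢0 (trans (cong toℕ (σ-injective (Fin.toℕ-injective (trans point≡0 (sym point-first)))))
               (Fin.toℕ-fromℕ< _))

  index≢0 : ∀ {i} → 0 < point i → toℕ i ≢ 0
  index≢0 {i} 0<point i≡0 = ℕ.<⇒≢ 0<point (sym (trans (cong point (Fin.toℕ-injective
                              (trans i≡0 (sym (Fin.toℕ-fromℕ< _))))) point-first))

  yAt-toℕ : ∀ j → yAt fl N σ (toℕ j) ≡ fr (point j)
  yAt-toℕ j with toℕ j ℕ.<? N
  ... | yes j<N = cong (fr ∘ point) (Fin.fromℕ<-toℕ j j<N)
  ... | no j≮N = ⊥-elim (j≮N (Fin.toℕ<n j))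

  yAt-N : yAt fl N σ N ≡ 1ᴸ
  yAt-N with N ℕ.<? N
  ... | yes N<N = ⊥-elim (ℕ.<-irrefl refl N<N)
  ... | no _ = refl

  gap-inner : ∀ j j′ → toℕ j′ ≡ suc (toℕ j) → IsNextGap N (point j) (point j′) (gap fl N σ j)
  gap-inner j j′ j′≡1+j = record
    { m<N = Fin.toℕ<n (σ j)
    ; m′<N = Fin.toℕ<n (σ j′)
    ; m′≢m = λ eq → ℕ.<⇒≢ j<j′ (cong toℕ (sym (σ-injective (Fin.toℕ-injective eq))))
    ; g∈ = subst InUnit (sym gap≡) (InUnit-⊖ (fr-InUnit (point j)) (fr-InUnit (point j′)) (sorted j<j′))
    ; g-coefficient = cong proj₁ gap≡
    ; minimal = λ t<N t≢m X∈ coefficient → subst (_≼ _) (sym gap≡) (minimal t<N t≢m X∈ coefficient)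
    }
    where
    j<j′ : toℕ j < toℕ j′
    j<j′ = subst (toℕ j <_) (sym j′≡1+j) (ℕ.n<1+n (toℕ j))
    gap≡ : gap fl N σ j ≡ fr (point j′) ⊖ fr (point j)
    gap≡ = cong₂ _⊖_ (trans (cong (yAt fl N σ) (sym j′≡1+j)) (yAt-toℕ j′)) (yAt-toℕ j)
    minimal : ∀ {t X} → t < N → t ≢ point j → InUnit X → proj₁ X ≡ + t - + point j →
              fr (point j′) ⊖ fr (point j) ≼ X
    minimal {t} {X} t<N t≢m X∈ coefficient with point-surjective t<N
    ... | i , refl with ℕ.<-cmp (toℕ i) (toℕ j)
    ...   | tri< i<j _ _ = subst (_ ≼_) (sym (distance-wrap (sorted i<j) X∈ coefficient))
                             (≼-trans (⊖-monoˡ-≼ (fr (point j)) (inj₁ (proj₂ (fr-InUnit (point j′)))))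
                                      (≼-⊕ʳ (cofr (point j)) (proj₁ (fr-InUnit (point i)))))
    ...   | tri≈ _ i≡j _ = ⊥-elim (t≢m (cong point (Fin.toℕ-injective i≡j)))
    ...   | tri> _ _ j<i = subst (_ ≼_) (sym (distance-up (sorted j<i) X∈ coefficient))
                             (⊖-monoˡ-≼ (fr (point j)) (sorted-≤ (subst (_≤ toℕ i) (sym j′≡1+j) j<i)))

  gap-last : ∀ j → suc (toℕ j) ≡ N → IsNextGap N (point j) 0 (gap fl N σ j)
  gap-last j 1+j≡N = record
    { m<N = Fin.toℕ<n (σ j)
    ; m′<N = ℕ.<-trans ℕ.z<s 1<N
    ; m′≢m = point-j≢0 ∘ sym
    ; g∈ = subst InUnit (sym gap≡) (cofr-InUnit point-j≢0)
    ; g-coefficient = cong proj₁ gap≡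
    ; minimal = λ t<N t≢m X∈ coefficient → subst (_≼ _) (sym gap≡) (minimal t<N t≢m X∈ coefficient)
    }
    where
    point-j≢0 : point j ≢ 0
    point-j≢0 = point≢0 (λ j≡0 → ℕ.<⇒≢ 1<N (trans (cong suc (sym j≡0)) 1+j≡N))
    gap≡ : gap fl N σ j ≡ cofr (point j)
    gap≡ = cong₂ _⊖_ (trans (cong (yAt fl N σ) 1+j≡N) yAt-N) (yAt-toℕ j)
    minimal : ∀ {t X} → t < N → t ≢ point j → InUnit X → proj₁ X ≡ + t - + point j → cofr (point j) ≼ X
    minimal {t} {X} t<N t≢m X∈ coefficient with point-surjective t<N
    ... | i , refl = subst (_ ≼_) (sym (distance-wrap (sorted i<j) X∈ coefficient))
                       (≼-⊕ʳ (cofr (point j)) (proj₁ (fr-InUnit (point i))))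
      where
      i<j : toℕ i < toℕ j
      i<j = ℕ.≤∧≢⇒< (ℕ.s≤s⁻¹ (subst (toℕ i <_) (sym 1+j≡N) (Fin.toℕ<n i)))
                    (λ i≡j → t≢m (cong point (Fin.toℕ-injective i≡j)))

  second last : Fin N
  second = fromℕ< 1<N
  last = fromℕ< (ℕ.≤-reflexive (ℕ.suc-pred N))

  u v : ℕ
  u = point second
  v = point last

  0<u : 0 < u
  0<u = ℕ.n≢0⇒n>0 (point≢0 (λ 1≡0 → ℕ.1+n≢0 (trans (sym (Fin.toℕ-fromℕ< 1<N)) 1≡0)))

  0<v : 0 < v
  0<v = ℕ.n≢0⇒n>0 (point≢0 λ last≡0 →
    ℕ.<⇒≢ 1<N (sym (trans (sym (ℕ.suc-pred N)) (cong suc (trans (sym (Fin.toℕ-fromℕ< _)) last≡0)))))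

  u-min : ∀ {d} → 0 < d → d < N → fr u ≼ fr d
  u-min 0<d d<N with point-surjective d<N
  ... | i , refl = sorted-≤ (subst (_≤ toℕ i) (sym (Fin.toℕ-fromℕ< 1<N)) (ℕ.n≢0⇒n>0 (index≢0 0<d)))

  v-max : ∀ {d} → 0 < d → d < N → fr d ≼ fr v
  v-max _ d<N with point-surjective d<N
  ... | i , refl = sorted-≤ (subst (toℕ i ≤_) (sym (Fin.toℕ-fromℕ< _)) i≤N-1)
    where i≤N-1 : toℕ i ≤ ℕ.pred N
          i≤N-1 = ℕ.≤-pred (subst (suc (toℕ i) ≤_) (sym (ℕ.suc-pred N)) (Fin.toℕ<n i))

  open Rules 0<u (Fin.toℕ<n (σ second)) 0<v (Fin.toℕ<n (σ last)) u-min v-max public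

module Word (α : IrrationalReal) (fl : ℕ → ℤ) (isFloor : IsFloor α fl)
            {N : ℕ} (1<N : 1 < N) (σ : Fin N → Fin N) (isSorting : IsSorting α fl N σ) where
  open LinearForms α
  open ThreeGap α fl isFloor
  open SortedPoints α fl isFloor 1<N σ isSorting

  pos : ℤ → Fin N
  pos = position

  toℕ-pos : ∀ J → toℕ (pos J) ≡ J %ℕ N
  toℕ-pos J = Fin.toℕ-fromℕ< (n%ℕd<d J N)

  mAt : ℤ → ℕ
  mAt J = point (pos J)

  gapAt : ℤ → Lin
  gapAt J = gap fl N σ (pos J)

  -- W α fl N σ J unfolds to letterOf (gapAt J).
  letterOf : Lin → Letter
  letterOf g =
    if does (Fin.all? (λ i → ≤? α (gap fl N σ i) g)) then c
    else if does (Fin.all? (λ i → ≤? α g (gap fl N σ i))) then a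
    else b

  letter-c⇒maximal : ∀ {g} → letterOf g ≡ c → ∀ i → gap fl N σ i ≼ g
  letter-c⇒maximal {g} letter≡c i =
    map₁ ≺⁺ (if-c (Fin.all? (λ i → ≤? α (gap fl N σ i) g)) (a/b≢c _) letter≡c i)
    where
    if-c : ∀ {P : Set} (d : Dec P) {x} → x ≢ c → (if does d then c else x) ≡ c → P
    if-c (yes p) _   _  = p
    if-c (no _)  x≢c eq = ⊥-elim (x≢c eq)
    a/b≢c : ∀ y → (if y then a else b) ≢ c
    a/b≢c true  ()
    a/b≢c false ()

  gap-next : ∀ J → IsNextGap N (mAt J) (mAt (J + + 1)) (gapAt J)
  gap-next J with %ℕ-suc {N} J
  ... | inj₁ eq = gap-inner (pos J) (pos (J + + 1))
                    (trans (toℕ-pos (J + + 1)) (trans eq (cong suc (sym (toℕ-pos J)))))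
  ... | inj₂ (1+r≡N , eq) = subst (λ m′ → IsNextGap N (mAt J) m′ (gapAt J)) (sym mAt[J+1]≡0)
                              (gap-last (pos J) (trans (cong suc (toℕ-pos J)) 1+r≡N))
    where
    mAt[J+1]≡0 : mAt (J + + 1) ≡ 0
    mAt[J+1]≡0 = trans (cong point (Fin.toℕ-injective (trans (toℕ-pos (J + + 1))
                                                           (trans eq (sym (Fin.toℕ-fromℕ< _))))))
                     point-first

  module _ {J : ℤ} (W≡c : W α fl N σ J ≡ c) where

    smaller : ∀ K → W α fl N σ K ≢ c → gapAt K ≺ gapAt J
    smaller K W≢c = ≼∧≢⇒≺ (letter-c⇒maximal {gapAt J} W≡c (pos K))
                          (λ eq → W≢c (trans (cong letterOf eq) W≡c))

    Balanced : ℕ → Set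
    Balanced i = mAt (J - + i) ℕ.+ mAt (J + + suc i) ≡ mAt J ℕ.+ mAt (J + + 1)

    mirror-step : ∀ i → Balanced i → W α fl N σ (J - + suc i) ≢ c → W α fl N σ (J + + suc i) ≢ c →
                  Balanced (suc i) × W α fl N σ (J - + suc i) ≡ W α fl N σ (J + + suc i)
    mirror-step i balanced left≢c right≢c = proj₁ mirrored , cong letterOf (proj₂ mirrored)
      where
      K K′ : ℤ
      K = J + + suc i
      K′ = J - + suc i
      right : IsNextGap N (mAt K) (mAt (J + + suc (suc i))) (gapAt K)
      right = subst (λ x → IsNextGap N (mAt K) (mAt x) (gapAt K)) (identity J (+ suc i)) (gap-next K)
        where identity : ∀ j x → (j + x) + + 1 ≡ j + (+ 1 + x)
              identity = solve-∀
      left : IsNextGap N (mAt K′) (mAt (J - + i)) (gapAt K′)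
      left = subst (λ x → IsNextGap N (mAt K′) (mAt x) (gapAt K′)) (identity J (+ i)) (gap-next K′)
        where identity : ∀ j x → (j - (+ 1 + x)) + + 1 ≡ j - x
              identity = solve-∀
      mirrored : Balanced (suc i) × gapAt K′ ≡ gapAt K
      mirrored = mirror {mAt J} {mAt (J + + 1)} {gapAt J} {mAt K} {mAt (J + + suc (suc i))} {gapAt K}
                        {mAt K′} {mAt (J - + i)} {gapAt K′}
                        (kind 1<N (gap-next J)) (kind 1<N right) (smaller K right≢c)
                        (kind 1<N left) (smaller K′ left≢c) (Fin.toℕ<n (σ (pos K′))) balanced

    NoCUpTo : ℕ → Set
    NoCUpTo k = ∀ t → 1 ≤ t → t ≤ k → (W α fl N σ (J - + t) ≢ c) × (W α fl N σ (J + + t) ≢ c)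

    balanced-symmetric : ∀ k → NoCUpTo k → Balanced k × W α fl N σ (J - + k) ≡ W α fl N σ (J + + k)
    balanced-symmetric zero _ = cong (λ K → mAt K ℕ.+ mAt (J + + 1)) (ℤ.+-identityʳ J) , refl
    balanced-symmetric (suc i) noC = mirror-step i (proj₁ (balanced-symmetric i noC-below)) left≢c right≢c
      where
      noC-below : NoCUpTo i
      noC-below t 1≤t t≤i = noC t 1≤t (ℕ.m≤n⇒m≤1+n t≤i)
      left≢c : W α fl N σ (J - + suc i) ≢ c
      left≢c = proj₁ (noC (suc i) (ℕ.s≤s ℕ.z≤n) ℕ.≤-refl)
      right≢c : W α fl N σ (J + + suc i) ≢ c
      right≢c = proj₂ (noC (suc i) (ℕ.s≤s ℕ.z≤n) ℕ.≤-refl)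

W-single-point : ∀ α fl {N} .{{_ : NonZero N}} σ → N ≤ 1 → ∀ J K → W α fl N σ J ≡ W α fl N σ K
W-single-point α fl {N} σ N≤1 J K =
  cong (letter α fl N σ) (Fin.toℕ-injective (trans (index≡0 (position J)) (sym (index≡0 (position K)))))
  where index≡0 : (i : Fin N) → toℕ i ≡ 0
        index≡0 i = ℕ.n<1⇒n≡0 (ℕ.<-≤-trans (Fin.toℕ<n i) N≤1)

mainTheorem1 : (α : IrrationalReal) (N : ℕ) .{{_ : NonZero N}}
    (fl : ℕ → ℤ) → IsFloor α fl →
    (σ : Fin N → Fin N) → IsSorting α fl N σ →
    (J : ℤ) → W α fl N σ J ≡ c →
    (k : ℕ) →
    (∀ (t : ℕ) → 1 ≤ t → t ≤ k →
       (W α fl N σ (J - + t) ≢ c) × (W α fl N σ (J + + t) ≢ c)) →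
    W α fl N σ (J - + k) ≡ W α fl N σ (J + + k)
mainTheorem1 α N fl isFloor σ isSorting J W≡c k noC with 1 ℕ.<? N
... | yes 1<N = proj₂ (Word.balanced-symmetric α fl isFloor 1<N σ isSorting {J} W≡c k noC)
mainTheorem1 α N fl isFloor σ isSorting J W≡c zero noC | no _ = refl
mainTheorem1 α N fl isFloor σ isSorting J W≡c (suc k) noC | no 1≮N =
  ⊥-elim (proj₁ (noC 1 ℕ.≤-refl (ℕ.s≤s ℕ.z≤n)) (trans (W-single-point α fl σ (ℕ.≮⇒≥ 1≮N) (J - + 1) J) W≡c))
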